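{- Let $n\ge1$ and let $G=(V,E)$ and $H=(V,F)$ be graphs on the common node set $V=\{1,\dots,n\}$ such that the edges of $H$ are pairwise node-disjoint. Let $t=\lvert F\rvert$, $k=n-t$, and let $V=V_1\cup\dots\cup V_k$ be the decomposition of $V$ into the node sets of the connected components of $H$. Assume that $E$ consists of exactly $\binom{k}{2}$ edges, namely for each $1\le i<j\le k$ exactly one edge $e_{ij}$, which joins a node of $V_i$ and a node of $V_j$. Assume moreover that $G$ contains a cycle $C$ of length four, and let $V_C$ be the set of its four nodes. Let $I'(G,H,C)$ denote the inequality, in variables $x_{uv}$ indexed by the edges of the complete graph on $V\cup\{n+1,n+2\}$, \[ \sum_{uv\in E} T(u,v;n+1)-\sum_{uv\in F}T(u,v;n+1)+2\sum_{i:\,V_i=\{u\}}x_{u,n+1}+\sum_{u\in V_C}\bigl(x_{u,n+1}-x_{u,n+2}\bigr)\le 2, \] where $T(u,v;w)=x_{uv}-x_{uw}-x_{vw}$ and the third sum runs over the components $V_i$ consisting of a single node $u$. Then $I'(G,H,C)$ is valid for $\mathrm{CUT}^\square_{n+2}$.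
   Context: For a graph with node set $W$ and edge set $D$, the cut vector $\boldsymbol{\delta}(S)\in\mathbb{R}^D$ of $S\subseteq W$ has $\delta_{uv}(S)=1$ if exactly one of $u,v$ lies in $S$, and $0$ otherwise. $\mathrm{CUT}^\square_N$ is the cut polytope of $\mathrm{K}_N$: the convex hull of all cut vectors of subsets of the node set of $\mathrm{K}_N$, in $\mathbb{R}^{E(\mathrm{K}_N)}$; here the nodes of $\mathrm{K}_{n+2}$ are $V\cup\{n+1,n+2\}$. An inequality is valid for a polytope if every point of the polytope satisfies it.
   Formalization: The polytope $\mathrm{CUT}^\square_{n+2}$ is taken over the rationals: its points have rational coordinates and are convex combinations of cut vectors with rational weights. -}

module Defs where

open import Data.Bool using (Bool; true; false; not; _∧_; if_then_else_)
open import Data.Nat using (ℕ; zero; suc)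
open import Data.Fin using (Fin; inject₁; fromℕ; _<_; _<?_)
open import Data.List using (List; []; _∷_; map; foldr; allFin; concatMap; filterᵇ)
open import Data.Bool.ListAction using (any)
open import Data.Product using (Σ; _×_; _,_; proj₁; proj₂; ∃)
open import Data.Rational using (ℚ; 0ℚ; 1ℚ; _+_; _-_; _*_; _≤_)
open import Data.List.Relation.Unary.All using (All)
open import Relation.Nullary using (does)
open import Relation.Binary.PropositionalEquality using (_≡_)

record Graph (n : ℕ) : Set where
  field
    adj    : Fin n → Fin n → Bool
    adj-sym : ∀ u v → adj u v ≡ adj v u
    adj-irr : ∀ u → adj u u ≡ false
open Graph public

sumℚ : List ℚ → ℚ
sumℚ = foldr _+_ 0ℚ

pairs : (n : ℕ) → List (Fin n × Fin n)
pairs n = concatMap (λ u → filterᵇ (λ p → does (proj₁ p <? proj₂ p)) (map (λ v → (u , v)) (allFin n))) (allFin n)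

edges : ∀ {n} → Graph n → List (Fin n × Fin n)
edges {n} G = filterᵇ (λ p → adj G (proj₁ p) (proj₂ p)) (pairs n)

ΣEdges : ∀ {n} → Graph n → (Fin n → Fin n → ℚ) → ℚ
ΣEdges G f = sumℚ (map (λ p → f (proj₁ p) (proj₂ p)) (edges G))

ΣNodes : ∀ n → (Fin n → Bool) → (Fin n → ℚ) → ℚ
ΣNodes n P f = sumℚ (map f (filterᵇ P (allFin n)))

EdgeK : ℕ → Set
EdgeK N = Σ (Fin N × Fin N) (λ p → proj₁ p < proj₂ p)

-- coordinate x_{uv} of a vector x ∈ ℚ^{E(K_N)} (for u ≠ v; 0 on the diagonal, never used)
coord : ∀ {N} → (EdgeK N → ℚ) → Fin N → Fin N → ℚ
coord x u v with u <? v
... | Relation.Nullary.yes p = x ((u , v) , p)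
... | Relation.Nullary.no _ with v <? u
...   | Relation.Nullary.yes q = x ((v , u) , q)
...   | Relation.Nullary.no _ = 0ℚ

Subset : ℕ → Set
Subset N = Fin N → Bool

xor : Bool → Bool → Bool
xor true b = not b
xor false b = b

δ : ∀ {N} → Subset N → EdgeK N → ℚ
δ S ((u , v) , _) = if xor (S u) (S v) then 1ℚ else 0ℚ

InCutPolytope : (N : ℕ) → (EdgeK N → ℚ) → Set
InCutPolytope N x =
  ∃ λ (c : List (ℚ × Subset N)) →
    All (λ p → 0ℚ ≤ proj₁ p) c
    × sumℚ (map proj₁ c) ≡ 1ℚ
    × (∀ e → x e ≡ sumℚ (map (λ p → proj₁ p * δ (proj₂ p) e) c))

ValidForCut : (N : ℕ) → ((EdgeK N → ℚ) → ℚ) → ℚ → Set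
ValidForCut N f b = ∀ x → InCutPolytope N x → f x ≤ b

-- Node set of K_{n+2}: Fin (suc (suc n)); node u ∈ V = Fin n is inject₁ (inject₁ u),
-- node n+1 is inject₁ (fromℕ n), node n+2 is fromℕ (suc n).

ι : ∀ {n} → Fin n → Fin (suc (suc n))
ι u = inject₁ (inject₁ u)

w₁ : ∀ n → Fin (suc (suc n))
w₁ n = inject₁ (fromℕ n)

w₂ : ∀ n → Fin (suc (suc n))
w₂ n = fromℕ (suc n)

T : ∀ {N} → (EdgeK N → ℚ) → Fin N → Fin N → Fin N → ℚ
T x u v w = coord x u v - coord x u w - coord x v w

isolated : ∀ {n} → Graph n → Fin n → Bool
isolated {n} H u = not (any (adj H u) (allFin n))

-- u and v lie in the same connected component of the matching H
SameComp : ∀ {n} → Graph n → Fin n → Fin n → Set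
SameComp H u v = (u ≡ v) Data.Sum.⊎ (adj H u v ≡ true)
  where import Data.Sum

two : ℚ
two = 1ℚ + 1ℚ

lhsI' : ∀ n → Graph n → Graph n → Fin n → Fin n → Fin n → Fin n → (EdgeK (suc (suc n)) → ℚ) → ℚ
lhsI' n G H a b c d x =
  ΣEdges G (λ u v → T x (ι u) (ι v) (w₁ n))
  - ΣEdges H (λ u v → T x (ι u) (ι v) (w₁ n))
  + two * ΣNodes n (isolated H) (λ u → coord x (ι u) (w₁ n))
  + sumℚ (map (λ u → coord x (ι u) (w₁ n) - coord x (ι u) (w₂ n)) (a ∷ b ∷ c ∷ d ∷ []))

module Submission where

open import Defs
open import Data.Nat using (ℕ; suc; _≥_)
open import Data.Fin using (Fin)
open import Data.Bool using (true)
open import Data.Product using (_×_; ∃₂)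
open import Relation.Nullary using (¬_)
open import Relation.Binary.PropositionalEquality using (_≡_; _≢_)

-- The left-hand side of I'(G,H,C) is linear in x, so it suffices to bound it on cut vectors
-- x = δ(S). Let B ⊆ V be the set of nodes that S separates from n+1, e the number of edges of G
-- inside B, M the number of components of H contained in B, and z whether S separates n+2
-- from n+1. Then T(u,v;n+1) = −2[u,v ∈ B] and x_{u,n+1} = [u ∈ B], so the left-hand side is
-- 2(M − e) + Σ_{u ∈ V_C} ([u ∈ B] − [u ∈ B] xor z). Any two components inside B are joined by
-- an edge of G inside B, so M(M − 1) ≤ 2e, whence M ≤ e + 1; if p nodes of the 4-cycle lie in B,
-- at least 2(p − 2) of its edges lie inside B, which improves this to M + (p − 2) ≤ e + 1.
-- The cycle terms cancel when z is false and sum to 2p − 4 when z is true; either way the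
-- left-hand side is at most 2.

module LinearFunctionals where

  open import Algebra.Bundles using (CommutativeMonoid)
  import Algebra.Properties.CommutativeSemigroup as CommutativeSemigroupProperties
  open import Data.Fin using (_<?_)
  open import Data.List using (List; []; _∷_; map; filterᵇ; allFin)
  open import Data.List.Properties using (map-cong)
  open import Data.List.Relation.Unary.All using (All; []; _∷_)
  open import Data.Product using (_,_; proj₁; proj₂)
  open import Data.Rational using (ℚ; 0ℚ; 1ℚ; _+_; _-_; _*_; -_; _≤_; nonNegative)
  import Data.Rational.Properties as ℚ
  open import Function using (_∘_)
  open import Relation.Binary.PropositionalEquality using (refl; sym; trans; cong; cong₂)
  open import Relation.Nullary using (yes; no)

  open CommutativeSemigroupProperties (CommutativeMonoid.commutativeSemigroup ℚ.+-0-commutativeMonoid)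
    using (interchange)
  open CommutativeSemigroupProperties (CommutativeMonoid.commutativeSemigroup ℚ.*-1-commutativeMonoid)
    using () renaming (x∙yz≈y∙xz to *-swapˡ)

  private variable
    A : Set

  sumℚ-map-+ : ∀ (f g : A → ℚ) xs → sumℚ (map (λ x → f x + g x) xs) ≡ sumℚ (map f xs) + sumℚ (map g xs)
  sumℚ-map-+ f g []       = refl
  sumℚ-map-+ f g (x ∷ xs) = trans (cong (f x + g x +_) (sumℚ-map-+ f g xs)) (interchange (f x) (g x) _ _)

  sumℚ-map-neg : ∀ (f : A → ℚ) xs → sumℚ (map (λ x → - f x) xs) ≡ - sumℚ (map f xs)
  sumℚ-map-neg f []       = refl
  sumℚ-map-neg f (x ∷ xs) = trans (cong (- f x +_) (sumℚ-map-neg f xs)) (sym (ℚ.neg-distrib-+ (f x) _))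

  sumℚ-map-- : ∀ (f g : A → ℚ) xs → sumℚ (map (λ x → f x - g x) xs) ≡ sumℚ (map f xs) - sumℚ (map g xs)
  sumℚ-map-- f g xs = trans (sumℚ-map-+ f (λ x → - g x) xs) (cong (sumℚ (map f xs) +_) (sumℚ-map-neg g xs))

  sumℚ-map-*ˡ : ∀ k (f : A → ℚ) xs → sumℚ (map (λ x → k * f x) xs) ≡ k * sumℚ (map f xs)
  sumℚ-map-*ˡ k f []       = sym (ℚ.*-zeroʳ k)
  sumℚ-map-*ˡ k f (x ∷ xs) = trans (cong (k * f x +_) (sumℚ-map-*ˡ k f xs)) (sym (ℚ.*-distribˡ-+ k (f x) _))

  combination : List (ℚ × A) → (A → ℚ) → ℚ
  combination c f = sumℚ (map (λ p → proj₁ p * f (proj₂ p)) c)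

  combination-+ : ∀ c (f g : A → ℚ) → combination c (λ a → f a + g a) ≡ combination c f + combination c g
  combination-+ c f g = trans (cong sumℚ (map-cong (λ p → ℚ.*-distribˡ-+ (proj₁ p) (f (proj₂ p)) _) c))
                              (sumℚ-map-+ _ _ c)

  combination-neg : ∀ c (f : A → ℚ) → combination c (λ a → - f a) ≡ - combination c f
  combination-neg c f = trans (cong sumℚ (map-cong (λ p → sym (ℚ.neg-distribʳ-* (proj₁ p) (f (proj₂ p)))) c))
                              (sumℚ-map-neg _ c)

  combination-*ˡ : ∀ c k (f : A → ℚ) → combination c (λ a → k * f a) ≡ k * combination c f
  combination-*ˡ c k f = trans (cong sumℚ (map-cong (λ p → *-swapˡ (proj₁ p) k _) c)) (sumℚ-map-*ˡ k _ c)

  combination-mono-≤ : ∀ {c} (f g : A → ℚ) → All (λ p → 0ℚ ≤ proj₁ p) c → (∀ a → f a ≤ g a) →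
                       combination c f ≤ combination c g
  combination-mono-≤ f g []                        f≤g = ℚ.≤-refl
  combination-mono-≤ f g (_∷_ {w , a} 0≤w nonNeg) f≤g =
    ℚ.+-mono-≤ (ℚ.*-monoˡ-≤-nonNeg w {{nonNegative 0≤w}} (f≤g a)) (combination-mono-≤ f g nonNeg f≤g)

  combination-const : ∀ (c : List (ℚ × A)) k → combination c (λ _ → k) ≡ sumℚ (map proj₁ c) * k
  combination-const []      k = sym (ℚ.*-zeroˡ k)
  combination-const (p ∷ c) k = trans (cong (proj₁ p * k +_) (combination-const c k)) (sym (ℚ.*-distribʳ-+ k (proj₁ p) _))

  Linear : {I : Set} → ((I → ℚ) → ℚ) → Set₁
  Linear {I} F = ∀ {A : Set} (v : A → I → ℚ) c x → (∀ i → x i ≡ combination c (λ a → v a i)) →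
                 F x ≡ combination c (F ∘ v)

  module _ {I : Set} where

    linear-eval : ∀ (i : I) → Linear (λ x → x i)
    linear-eval i v c x x≡ = x≡ i

    linear-0 : Linear {I} (λ _ → 0ℚ)
    linear-0 v c x x≡ = sym (trans (combination-const c 0ℚ) (ℚ.*-zeroʳ (sumℚ (map proj₁ c))))

    linear-+ : ∀ {F G : (I → ℚ) → ℚ} → Linear F → Linear G → Linear (λ x → F x + G x)
    linear-+ {F} {G} lin-F lin-G v c x x≡ =
      trans (cong₂ _+_ (lin-F v c x x≡) (lin-G v c x x≡)) (sym (combination-+ c (F ∘ v) (G ∘ v)))

    linear-neg : ∀ {F : (I → ℚ) → ℚ} → Linear F → Linear (λ x → - F x)
    linear-neg {F} lin-F v c x x≡ = trans (cong -_ (lin-F v c x x≡)) (sym (combination-neg c (F ∘ v)))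

    linear-- : ∀ {F G : (I → ℚ) → ℚ} → Linear F → Linear G → Linear (λ x → F x - G x)
    linear-- lin-F lin-G = linear-+ lin-F (linear-neg lin-G)

    linear-*ˡ : ∀ k {F : (I → ℚ) → ℚ} → Linear F → Linear (λ x → k * F x)
    linear-*ˡ k {F} lin-F v c x x≡ = trans (cong (k *_) (lin-F v c x x≡)) (sym (combination-*ˡ c k (F ∘ v)))

    linear-sumℚ : ∀ (F : A → (I → ℚ) → ℚ) xs → (∀ a → Linear (F a)) →
                  Linear (λ x → sumℚ (map (λ a → F a x) xs))
    linear-sumℚ F []       lin-F = linear-0
    linear-sumℚ F (a ∷ xs) lin-F = linear-+ (lin-F a) (linear-sumℚ F xs lin-F)

  linear-coord : ∀ {N} (u v : Fin N) → Linear (λ x → coord x u v)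
  linear-coord u v with u <? v
  ... | yes u<v = linear-eval _
  ... | no _ with v <? u
  ...   | yes v<u = linear-eval _
  ...   | no _    = linear-0

  linear-T : ∀ {N} (u v w : Fin N) → Linear (λ x → T x u v w)
  linear-T u v w = linear-- (linear-- (linear-coord u v) (linear-coord u w)) (linear-coord v w)

  linear-lhsI' : ∀ n G H (a b c d : Fin n) → Linear (lhsI' n G H a b c d)
  linear-lhsI' n G H a b c d =
    linear-+ (linear-+ (linear-- (linear-ΣEdges G) (linear-ΣEdges H))
                       (linear-*ˡ two (linear-sumℚ (λ u x → coord x (ι u) (w₁ n)) (filterᵇ (isolated H) (allFin n))
                                                   (λ u → linear-coord (ι u) (w₁ n)))))
             (linear-sumℚ (λ u x → coord x (ι u) (w₁ n) - coord x (ι u) (w₂ n)) (a ∷ b ∷ c ∷ d ∷ [])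
                          (λ u → linear-- (linear-coord (ι u) (w₁ n)) (linear-coord (ι u) (w₂ n))))
    where
    linear-ΣEdges : ∀ K → Linear (λ x → ΣEdges K (λ u v → T x (ι u) (ι v) (w₁ n)))
    linear-ΣEdges K = linear-sumℚ (λ e x → T x (ι (proj₁ e)) (ι (proj₂ e)) (w₁ n)) (edges K)
                                   (λ e → linear-T (ι (proj₁ e)) (ι (proj₂ e)) (w₁ n))

  valid-from-cut-vectors : ∀ {N F} b → Linear F → (∀ S → F (δ S) ≤ b) → ValidForCut N F b
  valid-from-cut-vectors {F = F} b lin-F cut-bound x (c , nonNeg , total , x≡) = begin
    F x                              ≡⟨ lin-F δ c x x≡ ⟩
    combination c (F ∘ δ)            ≤⟨ combination-mono-≤ (F ∘ δ) (λ _ → b) nonNeg cut-bound ⟩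
    combination c (λ _ → b)          ≡⟨ combination-const c b ⟩
    sumℚ (map proj₁ c) * b           ≡⟨ cong (_* b) total ⟩
    1ℚ * b                           ≡⟨ ℚ.*-identityˡ b ⟩
    b                                ∎
    where open ℚ.≤-Reasoning

module FiniteSums where

  open import Data.Bool using (Bool; true; false; if_then_else_)
  open import Data.Fin using (zero; suc; _≟_)
  open import Data.List using (List; []; _∷_; map; allFin; filterᵇ; concatMap; tabulate; _++_)
  open import Data.List.Properties using (map-cong-local; map-++)
  open import Data.List.Relation.Unary.All as All using ()
  open import Data.List.Relation.Unary.AllPairs using ([]; _∷_)
  open import Data.List.Relation.Unary.Unique.Propositional using (Unique)
  open import Data.Nat using (zero; _+_; _*_; _≤_; _<_; _<?_; z≤n; z<s)
  open import Data.Nat.ListAction using (sum)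
  open import Data.Nat.ListAction.Properties using (sum-++)
  open import Data.Nat.Properties hiding (_≟_)
  open import Data.Product using (∃; _,_)
  open import Function using (_∘_; id)
  open import Relation.Binary.PropositionalEquality using (refl; sym; trans; cong; subst; module ≡-Reasoning)
  open import Relation.Nullary using (does; yes; no; contradiction)
  open import Algebra.Properties.Semiring.Sum +-*-semiring
    using (sum-syntax; sum-cong-≗; sum-replicate-zero; ∑-distrib-+; ∑-comm; *-distribˡ-sum; *-distribʳ-sum)

  private variable
    A B : Set

  ∑-mono-≤ : ∀ {n} {f g : Fin n → ℕ} → (∀ i → f i ≤ g i) → (∑[ i < n ] f i) ≤ (∑[ i < n ] g i)
  ∑-mono-≤ {zero}  f≤g = z≤n
  ∑-mono-≤ {suc n} f≤g = +-mono-≤ (f≤g zero) (∑-mono-≤ (f≤g ∘ suc))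

  ∑-delta : ∀ {n} i (f : Fin n → ℕ) → (∑[ j < n ] (if does (i ≟ j) then f j else 0)) ≡ f i
  ∑-delta {suc n} zero    f = trans (cong (f zero +_) (sum-replicate-zero n)) (+-identityʳ (f zero))
  ∑-delta {suc n} (suc i) f = ∑-delta i (f ∘ suc)

  ∑-split : ∀ {n} i (f : Fin n → ℕ) → (∑[ j < n ] f j) ≡ f i + (∑[ j < n ] (if does (i ≟ j) then 0 else f j))
  ∑-split {n} i f = begin
    ∑[ j < n ] f j                             ≡⟨ sum-cong-≗ split ⟩
    ∑[ j < n ] (at-i j + off-i j)              ≡⟨ ∑-distrib-+ at-i off-i ⟩
    (∑[ j < n ] at-i j) + (∑[ j < n ] off-i j) ≡⟨ cong (_+ (∑[ j < n ] off-i j)) (∑-delta i f) ⟩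
    f i + (∑[ j < n ] off-i j)                 ∎
    where
    open ≡-Reasoning
    at-i off-i : Fin n → ℕ
    at-i  j = if does (i ≟ j) then f j else 0
    off-i j = if does (i ≟ j) then 0 else f j
    split : ∀ j → f j ≡ at-i j + off-i j
    split j with does (i ≟ j)
    ... | true  = sym (+-identityʳ (f j))
    ... | false = refl

  sum-unique-≤-∑ : ∀ {n} (f : Fin n → ℕ) {xs} → Unique xs → sum (map f xs) ≤ (∑[ i < n ] f i)
  sum-unique-≤-∑ f {[]}     []               = z≤n
  sum-unique-≤-∑ f {x ∷ xs} (x∉xs ∷ unique) = begin
    f x + sum (map f xs)   ≡⟨ cong (λ ys → f x + sum ys) (map-cong-local (All.map off-x x∉xs)) ⟩
    f x + sum (map f′ xs)  ≤⟨ +-monoʳ-≤ (f x) (sum-unique-≤-∑ f′ unique) ⟩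
    f x + (∑[ j < _ ] f′ j)  ≡⟨ ∑-split x f ⟨
    ∑[ j < _ ] f j         ∎
    where
    open ≤-Reasoning
    f′ = λ j → if does (x ≟ j) then 0 else f j
    off-x : ∀ {y} → x ≢ y → f y ≡ f′ y
    off-x {y} x≢y with x ≟ y
    ... | yes x≡y = contradiction x≡y x≢y
    ... | no _    = refl

  ∑-term-≤ : ∀ {n} (f : Fin n → ℕ) i → f i ≤ (∑[ j < n ] f j)
  ∑-term-≤ {n} f i = subst (_≤ (∑[ j < n ] f j)) (+-identityʳ (f i)) (sum-unique-≤-∑ f {i ∷ []} (All.[] ∷ []))

  ∑-positive : ∀ {n} (f : Fin n → ℕ) → 0 < (∑[ i < n ] f i) → ∃ λ i → 0 < f i
  ∑-positive {suc n} f pos with f zero in f₀≡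
  ... | suc _ = zero , subst (0 <_) (sym f₀≡) z<s
  ... | zero  with ∑-positive (f ∘ suc) pos
  ...   | i , 0<fi = suc i , 0<fi

  ∑-≤1 : ∀ {n} (f : Fin n → ℕ) → (∀ i → f i ≤ 1) → (∀ {i j} → 0 < f i → 0 < f j → i ≡ j) →
         (∑[ i < n ] f i) ≤ 1
  ∑-≤1 {n} f f≤1 unique with 0 <? (∑[ i < n ] f i)
  ... | no ∑≯0 = ≤-trans (≮⇒≥ ∑≯0) z≤n
  ... | yes ∑>0 with ∑-positive f ∑>0
  ...   | i , 0<fi = begin
    ∑[ j < n ] f j                                   ≡⟨ sum-cong-≗ concentrated ⟩
    ∑[ j < n ] (if does (i ≟ j) then f j else 0)     ≡⟨ ∑-delta i f ⟩
    f i                                              ≤⟨ f≤1 i ⟩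
    1                                                ∎
    where
    open ≤-Reasoning
    concentrated : ∀ j → f j ≡ (if does (i ≟ j) then f j else 0)
    concentrated j with i ≟ j
    ... | yes _   = refl
    ... | no i≢j = n≤0⇒n≡0 (≮⇒≥ (λ 0<fj → i≢j (unique 0<fi 0<fj)))

  ∑⁴-comm : ∀ {m n} (f : Fin m → Fin m → Fin n → Fin n → ℕ) →
            (∑[ u < m ] ∑[ v < m ] ∑[ p < n ] ∑[ q < n ] f u v p q) ≡
            (∑[ p < n ] ∑[ q < n ] ∑[ u < m ] ∑[ v < m ] f u v p q)
  ∑⁴-comm {m} {n} f = begin
    ∑[ u < m ] ∑[ v < m ] ∑[ p < n ] ∑[ q < n ] f u v p q
      ≡⟨ sum-cong-≗ (λ u → ∑-comm (λ v p → ∑[ q < n ] f u v p q)) ⟩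
    ∑[ u < m ] ∑[ p < n ] ∑[ v < m ] ∑[ q < n ] f u v p q
      ≡⟨ ∑-comm (λ u p → ∑[ v < m ] ∑[ q < n ] f u v p q) ⟩
    ∑[ p < n ] ∑[ u < m ] ∑[ v < m ] ∑[ q < n ] f u v p q
      ≡⟨ sum-cong-≗ (λ p → sum-cong-≗ (λ u → ∑-comm (λ v q → f u v p q))) ⟩
    ∑[ p < n ] ∑[ u < m ] ∑[ q < n ] ∑[ v < m ] f u v p q
      ≡⟨ sum-cong-≗ (λ p → ∑-comm (λ u q → ∑[ v < m ] f u v p q)) ⟩
    ∑[ p < n ] ∑[ q < n ] ∑[ u < m ] ∑[ v < m ] f u v p q  ∎
    where open ≡-Reasoning

  ∑∑-product-≤ : ∀ {m n} (a : Fin m → ℕ) (b : Fin n → ℕ) x →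
                 (∑[ u < m ] a u) ≤ 1 → (∑[ v < n ] b v) ≤ 1 → (∑[ u < m ] ∑[ v < n ] (a u * (b v * x))) ≤ x
  ∑∑-product-≤ {m} {n} a b x ∑a≤1 ∑b≤1 = begin
    ∑[ u < m ] ∑[ v < n ] (a u * (b v * x))        ≡⟨ sum-cong-≗ (λ u → *-distribˡ-sum (a u) (λ v → b v * x)) ⟨
    ∑[ u < m ] (a u * (∑[ v < n ] (b v * x)))      ≡⟨ sum-cong-≗ (λ u → cong (a u *_) (*-distribʳ-sum x b)) ⟨
    ∑[ u < m ] (a u * ((∑[ v < n ] b v) * x))      ≡⟨ *-distribʳ-sum ((∑[ v < n ] b v) * x) a ⟨
    (∑[ u < m ] a u) * ((∑[ v < n ] b v) * x)      ≤⟨ *-mono-≤ ∑a≤1 (*-monoˡ-≤ x ∑b≤1) ⟩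
    1 * (1 * x)                                    ≡⟨ trans (*-identityˡ _) (*-identityˡ x) ⟩
    x                                              ∎
    where open ≤-Reasoning

  sum-map-tabulate : ∀ {n} (g : Fin n → A) (f : A → ℕ) → sum (map f (tabulate g)) ≡ ∑[ i < n ] f (g i)
  sum-map-tabulate {n = zero}  g f = refl
  sum-map-tabulate {n = suc n} g f = cong (f (g zero) +_) (sum-map-tabulate (g ∘ suc) f)

  sum-map-allFin : ∀ {n} (f : Fin n → ℕ) → sum (map f (allFin n)) ≡ ∑[ i < n ] f i
  sum-map-allFin = sum-map-tabulate id

  sum-map-filterᵇ : ∀ (P : A → Bool) (f : A → ℕ) xs →
                    sum (map f (filterᵇ P xs)) ≡ sum (map (λ x → if P x then f x else 0) xs)
  sum-map-filterᵇ P f []       = refl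
  sum-map-filterᵇ P f (x ∷ xs) with P x
  ... | true  = cong (f x +_) (sum-map-filterᵇ P f xs)
  ... | false = sum-map-filterᵇ P f xs

  sum-map-concatMap : ∀ (g : A → List B) (f : B → ℕ) xs →
                      sum (map f (concatMap g xs)) ≡ sum (map (λ x → sum (map f (g x))) xs)
  sum-map-concatMap g f []       = refl
  sum-map-concatMap g f (x ∷ xs) = begin
    sum (map f (g x ++ concatMap g xs))               ≡⟨ cong sum (map-++ f (g x) _) ⟩
    sum (map f (g x) ++ map f (concatMap g xs))       ≡⟨ sum-++ (map f (g x)) _ ⟩
    sum (map f (g x)) + sum (map f (concatMap g xs))  ≡⟨ cong (sum (map f (g x)) +_) (sum-map-concatMap g f xs) ⟩
    sum (map f (g x)) + sum (map (λ x → sum (map f (g x))) xs) ∎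
    where open ≡-Reasoning

module Counting where

  open FiniteSums
  open import Data.Bool using (Bool; true; false; not; _∧_; _∨_; if_then_else_)
  import Data.Bool.Properties as Bool
  open import Data.Bool.ListAction using (any)
  open import Data.Empty using (⊥; ⊥-elim)
  open import Data.Fin using (zero; suc; _<?_; _≟_) renaming (_<_ to _<ᶠ_)
  open import Data.Fin.Properties using (<-cmp; <-asym)
  open import Data.List using ([]; _∷_; map; allFin; filterᵇ; length)
  open import Data.List.Properties using (map-cong; map-∘)
  open import Data.List.Membership.Propositional using (lose)
  open import Data.List.Membership.Propositional.Properties using (∈-allFin)
  open import Data.List.Relation.Unary.Any.Properties using (any⁺)
  open import Data.List.Relation.Unary.All using ([]; _∷_)
  open import Data.List.Relation.Unary.AllPairs using ([]; _∷_)
  open import Data.Nat using (zero; _+_; _*_; _∸_; _≤_; _<_; _≤?_; z≤n; s≤s; z<s)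
  open import Data.Nat.ListAction using (sum)
  open import Data.Nat.Properties hiding (_≟_; _<?_; <-cmp; <-asym)
  open import Data.Nat.Tactic.RingSolver using (solve-∀)
  open import Data.Product using (∃; _,_; proj₁; proj₂)
  open import Data.Sum using (_⊎_; inj₁; inj₂)
  open import Function using (_∘_; Equivalence)
  open import Relation.Binary.Definitions using (tri<; tri≈; tri>)
  open import Relation.Binary.PropositionalEquality
  open import Relation.Nullary using (Dec; does; yes; no; contradiction)
  open import Relation.Nullary.Decidable using (dec-true; dec-false)
  open import Algebra.Properties.Semiring.Sum +-*-semiring
    using (sum-syntax; sum-cong-≗; ∑-distrib-+; ∑-comm; *-distribˡ-sum; *-distribʳ-sum)

  private variable
    A : Set

  ⟦_⟧ : Bool → ℕ
  ⟦ true  ⟧ = 1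
  ⟦ false ⟧ = 0

  ⟦⟧≤1 : ∀ b → ⟦ b ⟧ ≤ 1
  ⟦⟧≤1 true  = s≤s z≤n
  ⟦⟧≤1 false = z≤n

  ⟦⟧-positive : ∀ {b} → 0 < ⟦ b ⟧ → b ≡ true
  ⟦⟧-positive {true} _ = refl

  ⟦⟧+-positive : ∀ b {s} → 0 < ⟦ b ⟧ + s → b ≡ true ⊎ 0 < s
  ⟦⟧+-positive true  _   = inj₁ refl
  ⟦⟧+-positive false pos = inj₂ pos

  ⟦⟧+-≤1 : ∀ b {s} → s ≤ 1 → (b ≡ true → s ≡ 0) → ⟦ b ⟧ + s ≤ 1
  ⟦⟧+-≤1 true  s≤1 s≡0 = subst (λ s → 1 + s ≤ 1) (sym (s≡0 refl)) ≤-refl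
  ⟦⟧+-≤1 false s≤1 _   = s≤1

  ≡1⇒positive : ∀ {m} → m ≡ 1 → 0 < m
  ≡1⇒positive refl = z<s

  ∧-true : ∀ a {b} → a ∧ b ≡ true → a ≡ true × b ≡ true
  ∧-true true b≡true = refl , b≡true

  does-true : ∀ {P : Set} (P? : Dec P) → does P? ≡ true → P
  does-true (yes p) _ = p

  ⟦∧⟧ : ∀ a b → ⟦ a ∧ b ⟧ ≡ (if a then ⟦ b ⟧ else 0)
  ⟦∧⟧ true  b = refl
  ⟦∧⟧ false b = refl

  sum-filterᵇ-allFin : ∀ {n} (P Q : Fin n → Bool) →
                       sum (map (⟦_⟧ ∘ Q) (filterᵇ P (allFin n))) ≡ ∑[ u < n ] ⟦ P u ∧ Q u ⟧
  sum-filterᵇ-allFin {n} P Q = trans (sum-map-filterᵇ P (⟦_⟧ ∘ Q) (allFin n))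
    (trans (sum-map-allFin (λ u → if P u then ⟦ Q u ⟧ else 0)) (sum-cong-≗ (λ u → sym (⟦∧⟧ (P u) (Q u)))))

  ⟦∧∧⟧ : ∀ a b c → (if a then (if b then ⟦ c ⟧ else 0) else 0) ≡ ⟦ a ∧ (b ∧ c) ⟧
  ⟦∧∧⟧ true  b c = sym (⟦∧⟧ b c)
  ⟦∧∧⟧ false b c = refl

  sum-edges : ∀ {n} (K : Graph n) (P : Fin n → Fin n → Bool) →
              sum (map (λ e → ⟦ P (proj₁ e) (proj₂ e) ⟧) (edges K)) ≡
              ∑[ u < n ] ∑[ v < n ] ⟦ does (u <? v) ∧ (adj K u v ∧ P u v) ⟧
  sum-edges {n} K P = begin
    sum (map F (filterᵇ (λ e → adj K (proj₁ e) (proj₂ e)) (pairs n)))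
      ≡⟨ sum-map-filterᵇ _ F (pairs n) ⟩
    sum (map F′ (pairs n))
      ≡⟨ sum-map-concatMap (λ u → filterᵇ ordered (map (u ,_) (allFin n))) F′ (allFin n) ⟩
    sum (map (λ u → sum (map F′ (filterᵇ ordered (map (u ,_) (allFin n))))) (allFin n))
      ≡⟨ sum-map-allFin (λ u → sum (map F′ (filterᵇ ordered (map (u ,_) (allFin n))))) ⟩
    ∑[ u < n ] sum (map F′ (filterᵇ ordered (map (u ,_) (allFin n))))
      ≡⟨ sum-cong-≗ row ⟩
    ∑[ u < n ] ∑[ v < n ] ⟦ does (u <? v) ∧ (adj K u v ∧ P u v) ⟧ ∎
    where
    open ≡-Reasoning
    F F′ : Fin n × Fin n → ℕ
    F  e = ⟦ P (proj₁ e) (proj₂ e) ⟧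
    F′ e = if adj K (proj₁ e) (proj₂ e) then F e else 0
    ordered : Fin n × Fin n → Bool
    ordered e = does (proj₁ e <? proj₂ e)
    row : ∀ u → sum (map F′ (filterᵇ ordered (map (u ,_) (allFin n)))) ≡
                ∑[ v < n ] ⟦ does (u <? v) ∧ (adj K u v ∧ P u v) ⟧
    row u = begin
      sum (map F′ (filterᵇ ordered (map (u ,_) (allFin n))))
        ≡⟨ sum-map-filterᵇ ordered F′ (map (u ,_) (allFin n)) ⟩
      sum (map (λ e → if ordered e then F′ e else 0) (map (u ,_) (allFin n)))
        ≡⟨ cong sum (map-∘ (allFin n)) ⟨
      sum (map (λ v → if does (u <? v) then F′ (u , v) else 0) (allFin n))
        ≡⟨ sum-map-allFin (λ v → if does (u <? v) then F′ (u , v) else 0) ⟩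
      ∑[ v < n ] (if does (u <? v) then F′ (u , v) else 0)
        ≡⟨ sum-cong-≗ (λ v → ⟦∧∧⟧ (does (u <? v)) (adj K u v) (P u v)) ⟩
      ∑[ v < n ] ⟦ does (u <? v) ∧ (adj K u v ∧ P u v) ⟧ ∎

  induced : ∀ {n} → Graph n → (Fin n → Bool) → Graph n
  induced K β = record
    { adj     = λ u v → adj K u v ∧ (β u ∧ β v)
    ; adj-sym = λ u v → cong₂ _∧_ (adj-sym K u v) (Bool.∧-comm (β u) (β v))
    ; adj-irr = λ u → cong (_∧ (β u ∧ β u)) (adj-irr K u)
    }

  edgeCount : ∀ {n} → Graph n → ℕ
  edgeCount {n} K = ∑[ u < n ] ∑[ v < n ] ⟦ does (u <? v) ∧ adj K u v ⟧

  degree : ∀ {n} → Graph n → Fin n → ℕ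
  degree {n} K u = ∑[ v < n ] ⟦ adj K u v ⟧

  sum-edges-induced : ∀ {n} (K : Graph n) β →
                      sum (map (λ e → ⟦ β (proj₁ e) ∧ β (proj₂ e) ⟧) (edges K)) ≡ edgeCount (induced K β)
  sum-edges-induced K β = sum-edges K (λ u v → β u ∧ β v)

  handshake : ∀ {n} (K : Graph n) → (∑[ u < n ] degree K u) ≡ edgeCount K + edgeCount K
  handshake {n} K = begin
    ∑[ u < n ] ∑[ v < n ] ⟦ adj K u v ⟧
      ≡⟨ sum-cong-≗ (λ u → sum-cong-≗ (split u)) ⟩
    ∑[ u < n ] ∑[ v < n ] (forward u v + forward v u)
      ≡⟨ sum-cong-≗ (λ u → ∑-distrib-+ (forward u) (λ v → forward v u)) ⟩
    ∑[ u < n ] ((∑[ v < n ] forward u v) + (∑[ v < n ] forward v u))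
      ≡⟨ ∑-distrib-+ (λ u → ∑[ v < n ] forward u v) (λ u → ∑[ v < n ] forward v u) ⟩
    edgeCount K + (∑[ u < n ] ∑[ v < n ] forward v u)
      ≡⟨ cong (edgeCount K +_) (∑-comm (λ u v → forward v u)) ⟩
    edgeCount K + edgeCount K ∎
    where
    open ≡-Reasoning
    forward : Fin n → Fin n → ℕ
    forward u v = ⟦ does (u <? v) ∧ adj K u v ⟧
    split : ∀ u v → ⟦ adj K u v ⟧ ≡ forward u v + forward v u
    split u v with <-cmp u v
    ... | tri< u<v _ v≮u rewrite dec-true (u <? v) u<v | dec-false (v <? u) v≮u = sym (+-identityʳ _)
    ... | tri> u≮v _ v<u rewrite dec-false (u <? v) u≮v | dec-true (v <? u) v<u = cong ⟦_⟧ (adj-sym K u v)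
    ... | tri≈ u≮u refl _ rewrite dec-false (u <? u) u≮u | adj-irr K u = refl

  isolated-¬adj : ∀ {n} (K : Graph n) {u v} → isolated K u ≡ true → adj K u v ≡ true → ⊥
  isolated-¬adj {n} K {u} {v} iso uv = contradiction (trans (sym iso) (cong not some-neighbour)) λ ()
    where
    some-neighbour : any (adj K u) (allFin n) ≡ true
    some-neighbour = Equivalence.to Bool.T-≡ (any⁺ (adj K u) (lose (∈-allFin v) (Equivalence.from Bool.T-≡ uv)))

  module ComponentsInside {n} (G H : Graph n)
    (matching : ∀ u v w → adj H u v ≡ true → adj H u w ≡ true → v ≡ w)
    (joined : ∀ u v → ¬ SameComp H u v → ∃₂ λ p q → SameComp H p u × SameComp H q v × adj G p q ≡ true)
    (β : Fin n → Bool) where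

    upNeighbour : Fin n → Fin n → ℕ
    upNeighbour u v = ⟦ does (u <? v) ∧ adj (induced H β) u v ⟧

    upDegree : Fin n → ℕ
    upDegree u = ∑[ v < n ] upNeighbour u v

    -- ρ u = 1 exactly when u represents a component of H inside β: u is isolated in H, or the
    -- smaller end of its H-edge. Hence ρ sums to the number of components of H inside β.
    ρ : Fin n → ℕ
    ρ u = ⟦ isolated H u ∧ β u ⟧ + upDegree u

    componentCount : ℕ
    componentCount = ∑[ u < n ] ρ u

    componentCount≡ : componentCount ≡ edgeCount (induced H β) + ∑[ u < n ] ⟦ isolated H u ∧ β u ⟧
    componentCount≡ = trans (∑-distrib-+ (λ u → ⟦ isolated H u ∧ β u ⟧) upDegree)
                            (+-comm (∑[ u < n ] ⟦ isolated H u ∧ β u ⟧) (edgeCount (induced H β)))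

    upNeighbour-positive : ∀ {u v} → 0 < upNeighbour u v → u <ᶠ v × adj H u v ≡ true × β u ≡ true × β v ≡ true
    upNeighbour-positive {u} {v} pos =
      let u<v , inside = ∧-true (does (u <? v)) (⟦⟧-positive pos)
          uv  , βu∧βv  = ∧-true (adj H u v) inside
          βu  , βv     = ∧-true (β u) βu∧βv
      in does-true (u <? v) u<v , uv , βu , βv

    ρ-positive : ∀ {u} → 0 < ρ u →
                 β u ≡ true × (isolated H u ≡ true ⊎ ∃ λ v → adj H u v ≡ true × β v ≡ true × u <ᶠ v)
    ρ-positive {u} pos with ⟦⟧+-positive (isolated H u ∧ β u) pos
    ... | inj₁ iso∧βu = let iso , βu = ∧-true (isolated H u) iso∧βu in βu , inj₁ iso
    ... | inj₂ upDegree>0 with ∑-positive (upNeighbour u) upDegree>0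
    ...   | v , term>0 = let u<v , uv , βu , βv = upNeighbour-positive term>0 in βu , inj₂ (v , uv , βv , u<v)

    ρ-adj-< : ∀ {u v} → 0 < ρ u → adj H u v ≡ true → u <ᶠ v
    ρ-adj-< pos uv with ρ-positive pos
    ... | _ , inj₁ iso                = ⊥-elim (isolated-¬adj H iso uv)
    ... | _ , inj₂ (w , uw , _ , u<w) = subst (_ <ᶠ_) (matching _ _ _ uw uv) u<w

    ρ-full : ∀ {u p} → 0 < ρ u → SameComp H p u → β p ≡ true
    ρ-full pos (inj₁ refl) = proj₁ (ρ-positive pos)
    ρ-full {u} {p} pos (inj₂ pu) with ρ-positive pos | trans (adj-sym H u p) pu
    ... | _ , inj₁ iso               | up = ⊥-elim (isolated-¬adj H iso up)
    ... | _ , inj₂ (v , uv , βv , _) | up = subst (λ x → β x ≡ true) (matching u v p uv up) βv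

    ρ-unique : ∀ {p u u′} → 0 < ρ u → 0 < ρ u′ → SameComp H p u → SameComp H p u′ → u ≡ u′
    ρ-unique _   _    (inj₁ refl) (inj₁ refl) = refl
    ρ-unique pos pos′ (inj₁ refl) (inj₂ uu′)  =
      ⊥-elim (<-asym (ρ-adj-< pos uu′) (ρ-adj-< pos′ (trans (adj-sym H _ _) uu′)))
    ρ-unique pos pos′ (inj₂ u′u)  (inj₁ refl) =
      ⊥-elim (<-asym (ρ-adj-< pos (trans (adj-sym H _ _) u′u)) (ρ-adj-< pos′ u′u))
    ρ-unique _   _    (inj₂ pu)   (inj₂ pu′)  = matching _ _ _ pu pu′

    upNeighbour-adj : ∀ {u v} → 0 < upNeighbour u v → adj H u v ≡ true
    upNeighbour-adj pos = proj₁ (proj₂ (upNeighbour-positive pos))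

    upDegree-≤1 : ∀ u → upDegree u ≤ 1
    upDegree-≤1 u = ∑-≤1 (upNeighbour u) (λ v → ⟦⟧≤1 _)
                         (λ pos pos′ → matching u _ _ (upNeighbour-adj pos) (upNeighbour-adj pos′))

    upDegree-isolated : ∀ {u} → isolated H u ≡ true → upDegree u ≡ 0
    upDegree-isolated {u} iso = n≤0⇒n≡0 (≮⇒≥ λ upDegree>0 →
      let v , term>0 = ∑-positive (upNeighbour u) upDegree>0 in isolated-¬adj H iso (upNeighbour-adj {u} {v} term>0))

    ρ≤1 : ∀ u → ρ u ≤ 1
    ρ≤1 u = ⟦⟧+-≤1 (isolated H u ∧ β u) (upDegree-≤1 u)
                   (λ iso∧βu → upDegree-isolated (proj₁ (∧-true (isolated H u) iso∧βu)))

    κ : Fin n → Fin n → ℕ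
    κ p u = if does (p ≟ u) ∨ adj H p u then ρ u else 0

    κ-positive : ∀ {p u} → 0 < κ p u → 0 < ρ u × SameComp H p u
    κ-positive {p} {u} pos with p ≟ u | adj H p u
    ... | yes p≡u | _    = pos , inj₁ p≡u
    ... | no _    | true = pos , inj₂ refl

    κ-same : ∀ {p u} → SameComp H p u → κ p u ≡ ρ u
    κ-same {p} (inj₁ refl) rewrite dec-true (p ≟ p) refl = refl
    κ-same {p} {u} (inj₂ pu) rewrite pu | Bool.∨-zeroʳ (does (p ≟ u)) = refl

    κ≤ρ : ∀ p u → κ p u ≤ ρ u
    κ≤ρ p u with does (p ≟ u) ∨ adj H p u
    ... | true  = ≤-refl
    ... | false = z≤n

    ∑κ≤1 : ∀ p → (∑[ u < n ] κ p u) ≤ 1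
    ∑κ≤1 p = ∑-≤1 (κ p) (λ u → ≤-trans (κ≤ρ p u) (ρ≤1 u)) λ pos pos′ →
      let ρu>0 , pu = κ-positive pos ; ρu′>0 , pu′ = κ-positive pos′ in ρ-unique ρu>0 ρu′>0 pu pu′

    arc : Fin n → Fin n → ℕ
    arc p q = ⟦ adj (induced G β) p q ⟧

    ρ-0or1 : ∀ u → ρ u ≡ 0 ⊎ ρ u ≡ 1
    ρ-0or1 u with ρ u | ρ≤1 u
    ... | zero  | _       = inj₁ refl
    ... | suc _ | s≤s z≤n = inj₂ refl

    -- Two distinct representatives u, v are charged to an edge p–q of G inside β with p in the
    -- component of u and q in that of v; since ∑κ≤1, no ordered edge is charged twice.
    pair-bound : ∀ u v → ρ u * ρ v ≤
                 (if does (u ≟ v) then ρ v else 0) + ∑[ p < n ] ∑[ q < n ] (κ p u * (κ q v * arc p q))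
    pair-bound u v with ρ-0or1 u | ρ-0or1 v
    ... | inj₁ ρu≡0 | _         rewrite ρu≡0 = z≤n
    ... | inj₂ _    | inj₁ ρv≡0 rewrite ρv≡0 | *-zeroʳ (ρ u) = z≤n
    ... | inj₂ ρu≡1 | inj₂ ρv≡1 with u ≟ v
    ...   | yes refl rewrite ρu≡1 = s≤s z≤n
    ...   | no u≢v with joined u v (λ uv → u≢v (ρ-unique (≡1⇒positive ρu≡1) (≡1⇒positive ρv≡1) (inj₁ refl) uv))
    ...     | p , q , pu , qv , pq = begin
      ρ u * ρ v
        ≡⟨ cong₂ _*_ ρu≡1 ρv≡1 ⟩
      1
        ≡⟨ witness ⟨
      κ p u * (κ q v * arc p q)
        ≤⟨ ∑-term-≤ (λ q → κ p u * (κ q v * arc p q)) q ⟩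
      ∑[ q < n ] (κ p u * (κ q v * arc p q))
        ≤⟨ ∑-term-≤ (λ p → ∑[ q < n ] (κ p u * (κ q v * arc p q))) p ⟩
      ∑[ p < n ] ∑[ q < n ] (κ p u * (κ q v * arc p q))
        ≡⟨⟩
      0 + ∑[ p < n ] ∑[ q < n ] (κ p u * (κ q v * arc p q)) ∎
      where
      open ≤-Reasoning
      witness : κ p u * (κ q v * arc p q) ≡ 1
      witness = cong₂ _*_ (trans (κ-same pu) ρu≡1)
                          (cong₂ _*_ (trans (κ-same qv) ρv≡1)
                                     (cong₂ (λ x y → ⟦ x ∧ y ⟧) pq
                                            (cong₂ _∧_ (ρ-full (≡1⇒positive ρu≡1) pu) (ρ-full (≡1⇒positive ρv≡1) qv))))

    componentCount-squared : componentCount * componentCount ≤ componentCount + ∑[ p < n ] degree (induced G β) p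
    componentCount-squared = begin
      M * M
        ≡⟨ *-distribʳ-sum M ρ ⟩
      ∑[ u < n ] (ρ u * M)
        ≡⟨ sum-cong-≗ (λ u → *-distribˡ-sum (ρ u) ρ) ⟩
      ∑[ u < n ] ∑[ v < n ] (ρ u * ρ v)
        ≤⟨ ∑-mono-≤ (λ u → ∑-mono-≤ (pair-bound u)) ⟩
      ∑[ u < n ] ∑[ v < n ] (diagonal u v + via u v)
        ≡⟨ sum-cong-≗ (λ u → ∑-distrib-+ (diagonal u) (via u)) ⟩
      ∑[ u < n ] ((∑[ v < n ] diagonal u v) + (∑[ v < n ] via u v))
        ≡⟨ ∑-distrib-+ (λ u → ∑[ v < n ] diagonal u v) (λ u → ∑[ v < n ] via u v) ⟩
      (∑[ u < n ] ∑[ v < n ] diagonal u v) + (∑[ u < n ] ∑[ v < n ] via u v)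
        ≡⟨ cong₂ _+_ (sum-cong-≗ (λ u → ∑-delta u ρ)) (∑⁴-comm (λ u v p q → κ p u * (κ q v * arc p q))) ⟩
      M + ∑[ p < n ] ∑[ q < n ] ∑[ u < n ] ∑[ v < n ] (κ p u * (κ q v * arc p q))
        ≤⟨ +-monoʳ-≤ M (∑-mono-≤ λ p → ∑-mono-≤ λ q → ∑∑-product-≤ (κ p) (κ q) (arc p q) (∑κ≤1 p) (∑κ≤1 q)) ⟩
      M + ∑[ p < n ] ∑[ q < n ] arc p q ∎
      where
      open ≤-Reasoning
      M = componentCount
      diagonal via : Fin n → Fin n → ℕ
      diagonal u v = if does (u ≟ v) then ρ v else 0
      via u v = ∑[ p < n ] ∑[ q < n ] (κ p u * (κ q v * arc p q))

    componentCount-bound : let M = edgeCount (induced H β) + ∑[ u < n ] ⟦ isolated H u ∧ β u ⟧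
                               e = edgeCount (induced G β)
                           in M * M ≤ M + (e + e)
    componentCount-bound = subst (λ M → M * M ≤ M + (e + e)) componentCount≡
                                 (subst (λ D → componentCount * componentCount ≤ componentCount + D)
                                        (handshake (induced G β)) componentCount-squared)
      where e = edgeCount (induced G β)

  halve-≤ : ∀ {m n} → m + m ≤ n + n → m ≤ n
  halve-≤ le = ≮⇒≥ λ n<m → <⇒≱ (+-mono-< n<m n<m) le

  two-neighbours-≤-degree : ∀ {n} (K : Graph n) x {y y′} → y ≢ y′ →
                            ⟦ adj K x y ⟧ + (⟦ adj K x y′ ⟧ + 0) ≤ degree K x
  two-neighbours-≤-degree K x y≢y′ = sum-unique-≤-∑ (λ v → ⟦ adj K x v ⟧) ((y≢y′ ∷ []) ∷ [] ∷ [])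

  four-cycle-≤-edgeCount : ∀ {n} (K : Graph n) {a b c d : Fin n} →
                           a ≢ b → a ≢ c → a ≢ d → b ≢ c → b ≢ d → c ≢ d →
                           ⟦ adj K a b ⟧ + ⟦ adj K b c ⟧ + ⟦ adj K c d ⟧ + ⟦ adj K d a ⟧ ≤ edgeCount K
  four-cycle-≤-edgeCount {n} K {a} {b} {c} {d} a≢b a≢c a≢d b≢c b≢d c≢d = halve-≤ (begin
    ab + bc + cd + da + (ab + bc + cd + da)
      ≡⟨ eight ab bc cd da ⟩
    (ab + (da + 0)) + ((bc + (ab + 0)) + ((cd + (bc + 0)) + ((da + (cd + 0)) + 0)))
      ≤⟨ +-mono-≤ (neighbours a b≢d) (+-mono-≤ (neighbours b (≢-sym a≢c))
           (+-mono-≤ (neighbours c (≢-sym b≢d)) (+-mono-≤ (neighbours d a≢c) ≤-refl))) ⟩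
    sum (map (degree K) (a ∷ b ∷ c ∷ d ∷ []))
      ≤⟨ sum-unique-≤-∑ (degree K) ((a≢b ∷ a≢c ∷ a≢d ∷ []) ∷ (b≢c ∷ b≢d ∷ []) ∷ (c≢d ∷ []) ∷ [] ∷ []) ⟩
    ∑[ x < n ] degree K x
      ≡⟨ handshake K ⟩
    edgeCount K + edgeCount K ∎)
    where
    open ≤-Reasoning
    ab = ⟦ adj K a b ⟧
    bc = ⟦ adj K b c ⟧
    cd = ⟦ adj K c d ⟧
    da = ⟦ adj K d a ⟧
    neighbours : ∀ x {y y′} → y ≢ y′ → ⟦ adj K x y ⟧ + (⟦ adj K y′ x ⟧ + 0) ≤ degree K x
    neighbours x {y} {y′} y≢y′ = subst (λ t → ⟦ adj K x y ⟧ + (t + 0) ≤ degree K x) (cong ⟦_⟧ (adj-sym K x y′))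
                                       (two-neighbours-≤-degree K x y≢y′)
    eight : ∀ x y z w → x + y + z + w + (x + y + z + w) ≡ (x + (w + 0)) + ((y + (x + 0)) + ((z + (y + 0)) + ((w + (z + 0)) + 0)))
    eight = solve-∀

  four-cycle-inside : ∀ a b c d → let p = sum (map ⟦_⟧ (a ∷ b ∷ c ∷ d ∷ [])) in
                      (p ∸ 2) + (p ∸ 2) ≤ ⟦ a ∧ b ⟧ + ⟦ b ∧ c ⟧ + ⟦ c ∧ d ⟧ + ⟦ d ∧ a ⟧
  four-cycle-inside true  true  true  true  = ≤-refl
  four-cycle-inside true  true  true  false = ≤-refl
  four-cycle-inside true  true  false true  = ≤-refl
  four-cycle-inside true  true  false false = z≤n
  four-cycle-inside true  false true  true  = ≤-refl
  four-cycle-inside true  false true  false = z≤n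
  four-cycle-inside true  false false true  = z≤n
  four-cycle-inside true  false false false = z≤n
  four-cycle-inside false true  true  true  = ≤-refl
  four-cycle-inside false true  true  false = z≤n
  four-cycle-inside false true  false true  = z≤n
  four-cycle-inside false true  false false = z≤n
  four-cycle-inside false false true  true  = z≤n
  four-cycle-inside false false true  false = z≤n
  four-cycle-inside false false false true  = z≤n
  four-cycle-inside false false false false = z≤n

  xor-false : ∀ b → xor b false ≡ b
  xor-false true  = refl
  xor-false false = refl

  twist-count : ∀ (β : A → Bool) z xs → let p = sum (map (⟦_⟧ ∘ β) xs) ; q = sum (map (λ x → ⟦ xor (β x) z ⟧) xs) in
                q ≡ p ⊎ p + q ≡ length xs
  twist-count β false xs = inj₁ (cong sum (map-cong (λ x → cong ⟦_⟧ (xor-false (β x))) xs))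
  twist-count β true  xs = inj₂ (complementary xs)
    where
    complementary : ∀ xs → sum (map (⟦_⟧ ∘ β) xs) + sum (map (λ x → ⟦ xor (β x) true ⟧) xs) ≡ length xs
    complementary []       = refl
    complementary (x ∷ xs) with β x
    ... | true  = cong suc (complementary xs)
    ... | false = trans (+-suc _ _) (cong suc (complementary xs))

  few-components : ∀ M e j → M * M ≤ M + (e + e) → j + j ≤ e → M + j ≤ 1 + e
  few-components M e j M²≤M+2e 2j≤e with M ≤? 1 + j
  ... | yes M≤1+j = begin
    M + j      ≤⟨ +-monoˡ-≤ j M≤1+j ⟩
    1 + (j + j)  ≤⟨ s≤s 2j≤e ⟩
    1 + e      ∎
    where open ≤-Reasoning
  ... | no M≰1+j with m≤n⇒∃[o]m+o≡n (≰⇒> M≰1+j)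
  ...   | r , refl = halve-≤ (+-cancelʳ-≤ j _ _ (+-cancelˡ-≤ M _ _ (begin
    M + ((M + j) + (M + j) + j)    ≤⟨ +-monoʳ-≤ M (+-monoʳ-≤ ((M + j) + (M + j)) (≤-trans (j≤j*j j) (m≤m+n _ _))) ⟩
    M + ((M + j) + (M + j) + X)    ≡⟨ square j r ⟨
    M * M + (2 + j)                ≤⟨ +-monoˡ-≤ (2 + j) M²≤M+2e ⟩
    M + (e + e) + (2 + j)          ≡⟨ rearrange M e j ⟩
    M + ((1 + e) + (1 + e) + j)    ∎)))
    where
    open ≤-Reasoning
    -- With M = 2 + j + r, M² − 3M − 2j + 2 = j² − j + r² + r + 2jr ≥ 0, i.e. 2(M + j − 1) ≤ M(M − 1).
    X = j * j + (r * r + r + 2 * j * r)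
    j≤j*j : ∀ j → j ≤ j * j
    j≤j*j zero    = z≤n
    j≤j*j (suc k) = m≤m+n (suc k) (k * suc k)
    square : ∀ j r → let M = 2 + j + r in M * M + (2 + j) ≡ M + ((M + j) + (M + j) + (j * j + (r * r + r + 2 * j * r)))
    square = solve-∀
    rearrange : ∀ M e j → M + (e + e) + (2 + j) ≡ M + ((1 + e) + (1 + e) + j)
    rearrange = solve-∀

  cut-count : ∀ M e p q → M * M ≤ M + (e + e) → (p ∸ 2) + (p ∸ 2) ≤ e → q ≡ p ⊎ p + q ≡ 4 →
              M + M + p ≤ 2 + (e + e + q)
  cut-count M e p q M²≤M+2e _ (inj₁ refl) = begin
    M + M + p               ≤⟨ +-monoˡ-≤ p (+-mono-≤ M≤1+e M≤1+e) ⟩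
    (1 + e) + (1 + e) + p   ≡⟨ rearrange e p ⟩
    2 + (e + e + p)         ∎
    where
    open ≤-Reasoning
    M≤1+e = subst (_≤ 1 + e) (+-identityʳ M) (few-components M e 0 M²≤M+2e z≤n)
    rearrange : ∀ e p → (1 + e) + (1 + e) + p ≡ 2 + (e + e + p)
    rearrange = solve-∀
  cut-count M e p q M²≤M+2e 2j≤e (inj₂ p+q≡4) = +-cancelˡ-≤ p _ _ (begin
    p + (M + M + p)                 ≡⟨ regroup M p ⟩
    (M + M) + (p + p)               ≤⟨ +-monoʳ-≤ (M + M) (+-mono-≤ p≤2+j p≤2+j) ⟩
    (M + M) + ((2 + j) + (2 + j))   ≡⟨ regroup′ M j ⟩
    (M + j) + (M + j) + 4           ≤⟨ +-monoˡ-≤ 4 (+-mono-≤ M+j≤1+e M+j≤1+e) ⟩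
    (1 + e) + (1 + e) + 4           ≡⟨ cong (λ s → (1 + e) + (1 + e) + s) p+q≡4 ⟨
    (1 + e) + (1 + e) + (p + q)     ≡⟨ regroup″ e p q ⟩
    p + (2 + (e + e + q))           ∎)
    where
    open ≤-Reasoning
    j = p ∸ 2
    p≤2+j = m≤n+m∸n p 2
    M+j≤1+e = few-components M e j M²≤M+2e 2j≤e
    regroup : ∀ M p → p + (M + M + p) ≡ (M + M) + (p + p)
    regroup = solve-∀
    regroup′ : ∀ M j → (M + M) + ((2 + j) + (2 + j)) ≡ (M + j) + (M + j) + 4
    regroup′ = solve-∀
    regroup″ : ∀ e p q → (1 + e) + (1 + e) + (p + q) ≡ p + (2 + (e + e + q))
    regroup″ = solve-∀

  four-cycle-bound : ∀ {n} (G : Graph n) (β : Fin n → Bool) {a b c d : Fin n} →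
                     a ≢ b → a ≢ c → a ≢ d → b ≢ c → b ≢ d → c ≢ d →
                     adj G a b ≡ true → adj G b c ≡ true → adj G c d ≡ true → adj G d a ≡ true →
                     let p = sum (map (⟦_⟧ ∘ β) (a ∷ b ∷ c ∷ d ∷ [])) in (p ∸ 2) + (p ∸ 2) ≤ edgeCount (induced G β)
  four-cycle-bound G β {a} {b} {c} {d} a≢b a≢c a≢d b≢c b≢d c≢d ab bc cd da =
    ≤-trans (four-cycle-inside (β a) (β b) (β c) (β d))
            (subst (_≤ edgeCount (induced G β)) cycle-edges
                   (four-cycle-≤-edgeCount (induced G β) a≢b a≢c a≢d b≢c b≢d c≢d))
    where
    Gβ = induced G β
    cycle-edges : ⟦ adj Gβ a b ⟧ + ⟦ adj Gβ b c ⟧ + ⟦ adj Gβ c d ⟧ + ⟦ adj Gβ d a ⟧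
                  ≡ ⟦ β a ∧ β b ⟧ + ⟦ β b ∧ β c ⟧ + ⟦ β c ∧ β d ⟧ + ⟦ β d ∧ β a ⟧
    cycle-edges rewrite ab | bc | cd | da = refl

module CutValues where

  open LinearFunctionals using (sumℚ-map-*ˡ; sumℚ-map--)
  open Counting using (⟦_⟧; induced; edgeCount; sum-edges-induced; sum-filterᵇ-allFin)
  open import Data.Bool using (Bool; false; _∧_; if_then_else_)
  open import Data.Fin using (_<?_)
  open import Data.Fin.Properties using (<-cmp)
  open import Data.List using ([]; _∷_; map; filterᵇ; allFin)
  open import Data.List.Properties using (map-cong)
  open import Data.Nat as ℕ using (zero; z≤n; s≤s)
  open import Data.Nat.ListAction using (sum)
  open import Data.Product using (proj₁; proj₂)
  open import Data.Rational using (ℚ; 0ℚ; 1ℚ; _+_; _-_; _*_; -_; _≤_)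
  import Data.Rational.Properties as ℚ
  open import Data.Rational.Solver using (module +-*-Solver)
  open import Function using (_∘_)
  open import Relation.Binary.Definitions using (tri<; tri≈; tri>)
  open import Relation.Binary.PropositionalEquality
  open import Relation.Nullary using (yes; no; contradiction)
  import Algebra.Properties.Monoid.Mult ℚ.+-0-monoid as Multiples
  open import Data.Nat.Properties using (+-*-semiring)
  open import Algebra.Properties.Semiring.Sum +-*-semiring using (sum-syntax)

  private variable
    A : Set

  ⌜_⌝ : ℕ → ℚ
  ⌜ m ⌝ = m Multiples.× 1ℚ

  ⌜⌝-+ : ∀ m n → ⌜ m ℕ.+ n ⌝ ≡ ⌜ m ⌝ + ⌜ n ⌝
  ⌜⌝-+ = Multiples.×-homo-+ 1ℚ

  ⌜⌝-nonNeg : ∀ m → 0ℚ ≤ ⌜ m ⌝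
  ⌜⌝-nonNeg zero    = ℚ.≤-refl
  ⌜⌝-nonNeg (suc m) = ℚ.+-mono-≤ (ℚ.nonNegative⁻¹ 1ℚ) (⌜⌝-nonNeg m)

  ⌜⌝-mono-≤ : ∀ {m n} → m ℕ.≤ n → ⌜ m ⌝ ≤ ⌜ n ⌝
  ⌜⌝-mono-≤ {n = n} z≤n = ⌜⌝-nonNeg n
  ⌜⌝-mono-≤ (s≤s m≤n)   = ℚ.+-monoʳ-≤ 1ℚ (⌜⌝-mono-≤ m≤n)

  sumℚ-map-⌜⌝ : ∀ (f : A → ℕ) xs → sumℚ (map (⌜_⌝ ∘ f) xs) ≡ ⌜ sum (map f xs) ⌝
  sumℚ-map-⌜⌝ f []       = refl
  sumℚ-map-⌜⌝ f (x ∷ xs) = trans (cong (⌜ f x ⌝ +_) (sumℚ-map-⌜⌝ f xs)) (sym (⌜⌝-+ (f x) _))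

  indicator : ∀ b → (if b then 1ℚ else 0ℚ) ≡ ⌜ ⟦ b ⟧ ⌝
  indicator true  = refl
  indicator false = refl

  xor-comm : ∀ a b → xor a b ≡ xor b a
  xor-comm true  true  = refl
  xor-comm true  false = refl
  xor-comm false true  = refl
  xor-comm false false = refl

  xor-cancelʳ : ∀ s t w → xor (xor s w) (xor t w) ≡ xor s t
  xor-cancelʳ true  true  true  = refl
  xor-cancelʳ true  true  false = refl
  xor-cancelʳ true  false true  = refl
  xor-cancelʳ true  false false = refl
  xor-cancelʳ false true  true  = refl
  xor-cancelʳ false true  false = refl
  xor-cancelʳ false false true  = refl
  xor-cancelʳ false false false = refl

  coord-δ : ∀ {N} (S : Subset N) u v → coord (δ S) u v ≡ ⌜ ⟦ xor (S u) (S v) ⟧ ⌝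
  coord-δ S u v with u <? v
  ... | yes _ = indicator _
  ... | no u≮v with v <? u
  ...   | yes _ = trans (indicator _) (cong (⌜_⌝ ∘ ⟦_⟧) (xor-comm (S v) (S u)))
  ...   | no v≮u with <-cmp u v
  ...     | tri< u<v _ _ = contradiction u<v u≮v
  ...     | tri> _ _ v<u = contradiction v<u v≮u
  ...     | tri≈ _ refl _ = cong (⌜_⌝ ∘ ⟦_⟧) (sym (xor-self (S u)))
    where
    xor-self : ∀ b → xor b b ≡ false
    xor-self true  = refl
    xor-self false = refl

  triangle-δ : ∀ x y → ⌜ ⟦ xor x y ⟧ ⌝ - ⌜ ⟦ x ⟧ ⌝ - ⌜ ⟦ y ⟧ ⌝ ≡ (- two) * ⌜ ⟦ x ∧ y ⟧ ⌝
  triangle-δ true  true  = refl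
  triangle-δ true  false = refl
  triangle-δ false true  = refl
  triangle-δ false false = refl

  module AtCut {n} (S : Subset (suc (suc n))) where

    side : Fin n → Bool
    side u = xor (S (ι u)) (S (w₁ n))

    twist : Bool
    twist = xor (S (w₂ n)) (S (w₁ n))

    coord-δ-side : ∀ u v → coord (δ S) (ι u) (ι v) ≡ ⌜ ⟦ xor (side u) (side v) ⟧ ⌝
    coord-δ-side u v = trans (coord-δ S (ι u) (ι v))
                             (cong (⌜_⌝ ∘ ⟦_⟧) (sym (xor-cancelʳ (S (ι u)) (S (ι v)) (S (w₁ n)))))

    coord-δ-w₂ : ∀ u → coord (δ S) (ι u) (w₂ n) ≡ ⌜ ⟦ xor (side u) twist ⟧ ⌝
    coord-δ-w₂ u = trans (coord-δ S (ι u) (w₂ n))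
                         (cong (⌜_⌝ ∘ ⟦_⟧) (sym (xor-cancelʳ (S (ι u)) (S (w₂ n)) (S (w₁ n)))))

    T-δ : ∀ u v → T (δ S) (ι u) (ι v) (w₁ n) ≡ (- two) * ⌜ ⟦ side u ∧ side v ⟧ ⌝
    T-δ u v = trans (cong₂ _-_ (cong₂ _-_ (coord-δ-side u v) (coord-δ S (ι u) (w₁ n))) (coord-δ S (ι v) (w₁ n)))
                    (triangle-δ (side u) (side v))

    ΣEdges-δ : ∀ (K : Graph n) →
               ΣEdges K (λ u v → T (δ S) (ι u) (ι v) (w₁ n)) ≡ (- two) * ⌜ edgeCount (induced K side) ⌝
    ΣEdges-δ K = begin
      sumℚ (map (λ e → T (δ S) (ι (proj₁ e)) (ι (proj₂ e)) (w₁ n)) (edges K))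
        ≡⟨ cong sumℚ (map-cong (λ e → T-δ (proj₁ e) (proj₂ e)) (edges K)) ⟩
      sumℚ (map (λ e → (- two) * ⌜ inside e ⌝) (edges K))
        ≡⟨ sumℚ-map-*ˡ (- two) (⌜_⌝ ∘ inside) (edges K) ⟩
      (- two) * sumℚ (map (⌜_⌝ ∘ inside) (edges K))
        ≡⟨ cong ((- two) *_) (trans (sumℚ-map-⌜⌝ inside (edges K)) (cong ⌜_⌝ (sum-edges-induced K side))) ⟩
      (- two) * ⌜ edgeCount (induced K side) ⌝ ∎
      where
      open ≡-Reasoning
      inside = λ (e : Fin n × Fin n) → ⟦ side (proj₁ e) ∧ side (proj₂ e) ⟧

    ΣNodes-δ : ∀ (H : Graph n) →
               ΣNodes n (isolated H) (λ u → coord (δ S) (ι u) (w₁ n)) ≡ ⌜ ∑[ u < n ] ⟦ isolated H u ∧ side u ⟧ ⌝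
    ΣNodes-δ H = trans (cong sumℚ (map-cong (λ u → coord-δ S (ι u) (w₁ n)) (filterᵇ (isolated H) (allFin n))))
                       (trans (sumℚ-map-⌜⌝ (⟦_⟧ ∘ side) (filterᵇ (isolated H) (allFin n)))
                              (cong ⌜_⌝ (sum-filterᵇ-allFin (isolated H) side)))

    pendants-δ : ∀ xs → sumℚ (map (λ u → coord (δ S) (ι u) (w₁ n) - coord (δ S) (ι u) (w₂ n)) xs)
                        ≡ ⌜ sum (map (⟦_⟧ ∘ side) xs) ⌝ - ⌜ sum (map (λ u → ⟦ xor (side u) twist ⟧) xs) ⌝
    pendants-δ xs = begin
      sumℚ (map (λ u → coord (δ S) (ι u) (w₁ n) - coord (δ S) (ι u) (w₂ n)) xs)
        ≡⟨ cong sumℚ (map-cong (λ u → cong₂ _-_ (coord-δ S (ι u) (w₁ n)) (coord-δ-w₂ u)) xs) ⟩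
      sumℚ (map (λ u → ⌜ ⟦ side u ⟧ ⌝ - ⌜ ⟦ xor (side u) twist ⟧ ⌝) xs)
        ≡⟨ sumℚ-map-- (⌜_⌝ ∘ ⟦_⟧ ∘ side) (λ u → ⌜ ⟦ xor (side u) twist ⟧ ⌝) xs ⟩
      sumℚ (map (⌜_⌝ ∘ ⟦_⟧ ∘ side) xs) - sumℚ (map (λ u → ⌜ ⟦ xor (side u) twist ⟧ ⌝) xs)
        ≡⟨ cong₂ _-_ (sumℚ-map-⌜⌝ (⟦_⟧ ∘ side) xs) (sumℚ-map-⌜⌝ (λ u → ⟦ xor (side u) twist ⟧) xs) ⟩
      ⌜ sum (map (⟦_⟧ ∘ side) xs) ⌝ - ⌜ sum (map (λ u → ⟦ xor (side u) twist ⟧) xs) ⌝ ∎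
      where open ≡-Reasoning

    lhsI'-δ : ∀ G H (a b c d : Fin n) → let C = a ∷ b ∷ c ∷ d ∷ [] in
              lhsI' n G H a b c d (δ S)
              ≡ (- two) * ⌜ edgeCount (induced G side) ⌝ - (- two) * ⌜ edgeCount (induced H side) ⌝
                + two * ⌜ ∑[ u < n ] ⟦ isolated H u ∧ side u ⟧ ⌝
                + (⌜ sum (map (⟦_⟧ ∘ side) C) ⌝ - ⌜ sum (map (λ u → ⟦ xor (side u) twist ⟧) C) ⌝)
    lhsI'-δ G H a b c d =
      cong₂ _+_ (cong₂ _+_ (cong₂ _-_ (ΣEdges-δ G) (ΣEdges-δ H)) (cong (two *_) (ΣNodes-δ H)))
                (pendants-δ (a ∷ b ∷ c ∷ d ∷ []))

  integral-bound : ∀ e h i p q → (h ℕ.+ i) ℕ.+ (h ℕ.+ i) ℕ.+ p ℕ.≤ 2 ℕ.+ (e ℕ.+ e ℕ.+ q) →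
                   (- two) * ⌜ e ⌝ - (- two) * ⌜ h ⌝ + two * ⌜ i ⌝ + (⌜ p ⌝ - ⌜ q ⌝) ≤ two
  integral-bound e h i p q le = begin
    (- two) * ⌜ e ⌝ - (- two) * ⌜ h ⌝ + two * ⌜ i ⌝ + (⌜ p ⌝ - ⌜ q ⌝)
      ≡⟨ solve 5 (λ E H I P Q → (:- con two) :* E :- (:- con two) :* H :+ con two :* I :+ (P :- Q)
                              := ((H :+ I) :+ (H :+ I) :+ P) :- (E :+ E :+ Q)) refl ⌜ e ⌝ ⌜ h ⌝ ⌜ i ⌝ ⌜ p ⌝ ⌜ q ⌝ ⟩
    ((⌜ h ⌝ + ⌜ i ⌝) + (⌜ h ⌝ + ⌜ i ⌝) + ⌜ p ⌝) - (⌜ e ⌝ + ⌜ e ⌝ + ⌜ q ⌝)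
      ≡⟨ cong₂ _-_ cast-P cast-Q ⟨
    ⌜ (h ℕ.+ i) ℕ.+ (h ℕ.+ i) ℕ.+ p ⌝ - ⌜ e ℕ.+ e ℕ.+ q ⌝
      ≤⟨ ℚ.+-monoˡ-≤ (- ⌜ e ℕ.+ e ℕ.+ q ⌝) (⌜⌝-mono-≤ le) ⟩
    ⌜ 2 ℕ.+ (e ℕ.+ e ℕ.+ q) ⌝ - ⌜ e ℕ.+ e ℕ.+ q ⌝
      ≡⟨ cong (_- ⌜ e ℕ.+ e ℕ.+ q ⌝) (⌜⌝-+ 2 (e ℕ.+ e ℕ.+ q)) ⟩
    two + ⌜ e ℕ.+ e ℕ.+ q ⌝ - ⌜ e ℕ.+ e ℕ.+ q ⌝
      ≡⟨ solve 1 (λ X → con two :+ X :- X := con two) refl ⌜ e ℕ.+ e ℕ.+ q ⌝ ⟩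
    two ∎
    where
    open ℚ.≤-Reasoning
    open +-*-Solver
    cast-P : ⌜ (h ℕ.+ i) ℕ.+ (h ℕ.+ i) ℕ.+ p ⌝ ≡ (⌜ h ⌝ + ⌜ i ⌝) + (⌜ h ⌝ + ⌜ i ⌝) + ⌜ p ⌝
    cast-P = trans (⌜⌝-+ ((h ℕ.+ i) ℕ.+ (h ℕ.+ i)) p)
                   (cong (_+ ⌜ p ⌝) (trans (⌜⌝-+ (h ℕ.+ i) (h ℕ.+ i)) (cong (λ x → x + x) (⌜⌝-+ h i))))
    cast-Q : ⌜ e ℕ.+ e ℕ.+ q ⌝ ≡ ⌜ e ⌝ + ⌜ e ⌝ + ⌜ q ⌝
    cast-Q = trans (⌜⌝-+ (e ℕ.+ e) q) (cong (_+ ⌜ q ⌝) (⌜⌝-+ e e))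

open import Data.Bool using (_∧_)
open import Data.List using ([]; _∷_; map)
open import Data.Nat using (_+_)
open import Data.Nat.Properties using (+-*-semiring)
open import Algebra.Properties.Semiring.Sum +-*-semiring using (sum-syntax)
open import Data.Nat.ListAction using (sum)
open import Data.Product using (_,_)
open import Function using (_∘_)
open import Data.Rational using (_≤_)
open import Relation.Binary.PropositionalEquality using (sym; subst)

open LinearFunctionals using (valid-from-cut-vectors; linear-lhsI')
open Counting using (⟦_⟧; induced; edgeCount; module ComponentsInside; four-cycle-bound; twist-count; cut-count)
open CutValues using (module AtCut; integral-bound)

proposition2 : (n : ℕ) → n ≥ 1 → (G H : Graph n)
    -- the edges of H are pairwise node-disjoint
    → (∀ u v w → adj H u v ≡ true → adj H u w ≡ true → v ≡ w)
    -- every edge of G joins two different components of H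
    → (∀ u v → adj G u v ≡ true → ¬ SameComp H u v)
    -- for any two different components V_i ∋ u, V_j ∋ v there is exactly one edge of G between them
    → (∀ u v → ¬ SameComp H u v →
         ∃₂ λ p q → SameComp H p u × SameComp H q v × adj G p q ≡ true
           × (∀ p' q' → SameComp H p' u → SameComp H q' v → adj G p' q' ≡ true → (p' ≡ p × q' ≡ q)))
    -- a 4-cycle a-b-c-d-a in G
    → (a b c d : Fin n)
    → a ≢ b → a ≢ c → a ≢ d → b ≢ c → b ≢ d → c ≢ d
    → adj G a b ≡ true → adj G b c ≡ true → adj G c d ≡ true → adj G d a ≡ true
    → ValidForCut (suc (suc n)) (lhsI' n G H a b c d) two
proposition2 n _ G H matching _ joined a b c d a≢b a≢c a≢d b≢c b≢d c≢d ab bc cd da =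
  valid-from-cut-vectors two (linear-lhsI' n G H a b c d) bound-at-cut
  where
  some-edge : ∀ u v → ¬ SameComp H u v → ∃₂ λ p q → SameComp H p u × SameComp H q v × adj G p q ≡ true
  some-edge u v u≁v = let p , q , pu , qv , pq , _ = joined u v u≁v in p , q , pu , qv , pq

  bound-at-cut : ∀ S → lhsI' n G H a b c d (δ S) ≤ two
  bound-at-cut S = subst (_≤ two) (sym (lhsI'-δ G H a b c d)) (integral-bound e h i p q
    (cut-count (h + i) e p q (ComponentsInside.componentCount-bound G H matching some-edge side)
                             (four-cycle-bound G side a≢b a≢c a≢d b≢c b≢d c≢d ab bc cd da)
                             (twist-count side twist C)))
    where
    open AtCut S
    C = a ∷ b ∷ c ∷ d ∷ []
    e = edgeCount (induced G side)
    h = edgeCount (induced H side)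
    i = ∑[ u < n ] ⟦ isolated H u ∧ side u ⟧
    p = sum (map (⟦_⟧ ∘ side) C)
    q = sum (map (λ u → ⟦ xor (side u) twist ⟧) C)
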